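{- Let $k$ be a positive integer and let $G_1,G_2\in\Delta_{k-1}$. Let $G$ be the graph obtained from the disjoint union of $G_1$ and $G_2$ by adding an edge $w_1w_2$, for some fixed $w_1\in V(G_1)$ and $w_2\in V(G_2)$. Then $G$ has linear rank-width exactly $k$.
   Context: Graphs are finite and simple. For $X\subseteq V(G)$, $\mathrm{cutrk}_G(X)$ is the binary rank of the submatrix of the adjacency matrix with rows $X$ and columns $V(G)\setminus X$. A linear layout of $G$ is an ordering $(v_1,\dots,v_n)$ of $V(G)$ with width $\max_i\mathrm{cutrk}_G(\{v_1,\dots,v_i\})$ (or $0$ if $n\le 1$). The linear rank-width is the minimum width of a linear layout. A delta composition of $G_1,G_2,G_3$ is obtained from their disjoint union by choosing $v_i\in V(G_i)$ and adding the triangle $v_1v_2v_3$. $\Delta_0=\{K_2\}$, and for $i\ge1$, $\Delta_i$ is the set of delta compositions of three (not necessarily distinct) graphs in $\Delta_{i-1}$, up to isomorphism. -}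

module Defs where

open import Data.Nat using (ℕ; zero; suc; _<_; _+_)
open import Data.Fin using (Fin; zero; suc; toℕ; splitAt; _↑ˡ_; _↑ʳ_; _≟_)
open import Data.Bool using (Bool; true; false; _∧_; _∨_; _xor_; not)
open import Data.Bool.Properties using (∧-comm)
open import Data.Sum using (_⊎_; inj₁; inj₂)
open import Data.Product using (Σ; ∃; _×_; _,_)
open import Relation.Nullary using (¬_)
open import Relation.Nullary.Decidable using (⌊_⌋)
open import Relation.Binary.PropositionalEquality using (_≡_; refl)
open import Function.Bundles using (_↔_; Inverse)

_==_ : ∀ {n} → Fin n → Fin n → Bool
x == y = ⌊ x ≟ y ⌋

record Graph : Set where
  field
    n      : ℕ
    adj    : Fin n → Fin n → Bool
    adj-sym : ∀ x y → adj x y ≡ adj y x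
    irrefl : ∀ x → adj x x ≡ false
open Graph public

_≅_ : Graph → Graph → Set
G ≅ H = Σ (Fin (n G) ↔ Fin (n H)) λ f →
          ∀ x y → adj H (Inverse.to f x) (Inverse.to f y) ≡ adj G x y

K₂ : Graph
K₂ = record { n = 2 ; adj = λ x y → not (x == y) ; adj-sym = s ; irrefl = i }
  where
  s : ∀ (x y : Fin 2) → not (x == y) ≡ not (y == x)
  s zero zero = refl
  s zero (suc zero) = refl
  s (suc zero) zero = refl
  s (suc zero) (suc zero) = refl
  i : ∀ (x : Fin 2) → not (x == x) ≡ false
  i zero = refl
  i (suc zero) = refl

-- Disjoint union of G and H, plus all edges xy with x ∈ V(G), p x, y ∈ V(H), q y.
-- Vertices of G are x ↑ˡ n H, vertices of H are n G ↑ʳ y.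
joinAdj : (G H : Graph) (p : Fin (n G) → Bool) (q : Fin (n H) → Bool) →
          Fin (n G) ⊎ Fin (n H) → Fin (n G) ⊎ Fin (n H) → Bool
joinAdj G H p q (inj₁ x) (inj₁ y) = adj G x y
joinAdj G H p q (inj₂ x) (inj₂ y) = adj H x y
joinAdj G H p q (inj₁ x) (inj₂ y) = p x ∧ q y
joinAdj G H p q (inj₂ x) (inj₁ y) = q x ∧ p y

joinAdj-sym : ∀ G H p q a b → joinAdj G H p q a b ≡ joinAdj G H p q b a
joinAdj-sym G H p q (inj₁ x) (inj₁ y) = adj-sym G x y
joinAdj-sym G H p q (inj₂ x) (inj₂ y) = adj-sym H x y
joinAdj-sym G H p q (inj₁ x) (inj₂ y) = ∧-comm (p x) (q y)
joinAdj-sym G H p q (inj₂ x) (inj₁ y) = ∧-comm (q x) (p y)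

joinAdj-irrefl : ∀ G H p q a → joinAdj G H p q a a ≡ false
joinAdj-irrefl G H p q (inj₁ x) = irrefl G x
joinAdj-irrefl G H p q (inj₂ x) = irrefl H x

join : (G H : Graph) → (Fin (n G) → Bool) → (Fin (n H) → Bool) → Graph
join G H p q = record
  { n = n G + n H
  ; adj = λ x y → joinAdj G H p q (splitAt (n G) x) (splitAt (n G) y)
  ; adj-sym = λ x y → joinAdj-sym G H p q (splitAt (n G) x) (splitAt (n G) y)
  ; irrefl = λ x → joinAdj-irrefl G H p q (splitAt (n G) x)
  }

edgeJoin : (G₁ G₂ : Graph) → Fin (n G₁) → Fin (n G₂) → Graph
edgeJoin G₁ G₂ w₁ w₂ = join G₁ G₂ (_== w₁) (_== w₂)

-- Delta composition: disjoint union of G₁, G₂, G₃ plus the triangle v₁v₂v₃.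
delta : (G₁ G₂ G₃ : Graph) → Fin (n G₁) → Fin (n G₂) → Fin (n G₃) → Graph
delta G₁ G₂ G₃ v₁ v₂ v₃ =
  join G₁ (edgeJoin G₂ G₃ v₂ v₃) (_== v₁)
       (λ y → (y == (v₂ ↑ˡ n G₃)) ∨ (y == (n G₂ ↑ʳ v₃)))

data InΔ : ℕ → Graph → Set where
  base : ∀ {G} → G ≅ K₂ → InΔ 0 G
  comp : ∀ {i G} (G₁ G₂ G₃ : Graph) →
         InΔ i G₁ → InΔ i G₂ → InΔ i G₃ →
         (v₁ : Fin (n G₁)) (v₂ : Fin (n G₂)) (v₃ : Fin (n G₃)) →
         G ≅ delta G₁ G₂ G₃ v₁ v₂ v₃ → InΔ (suc i) G

xorSum : ∀ {r} → (Fin r → Bool) → Bool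
xorSum {zero}  f = false
xorSum {suc r} f = f zero xor xorSum (λ j → f (suc j))

-- cutrk_G(X) ≥ r : there are r rows of the matrix A[X, V∖X] (over GF(2))
-- that are linearly independent, i.e. every nonempty subfamily T has nonzero sum.
CutRkAtLeast : (G : Graph) → (Fin (n G) → Set) → ℕ → Set
CutRkAtLeast G X r =
  Σ (Fin r → Fin (n G)) λ u →
    (∀ j → X (u j)) ×
    (∀ (T : Fin r → Bool) → (∃ λ j → T j ≡ true) →
       ∃ λ w → ¬ X w × (xorSum (λ j → T j ∧ adj G (u j) w) ≡ true))

-- A linear layout: bijection from positions to vertices (v_{j+1} = to j).
Layout : Graph → Set
Layout G = Fin (n G) ↔ Fin (n G)

InPrefix : (G : Graph) → Layout G → ℕ → Fin (n G) → Set
InPrefix G σ i v = toℕ (Inverse.from σ v) < i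

LinRankWidth : Graph → ℕ → Set
LinRankWidth G k =
  (Σ (Layout G) λ σ → ∀ i → ¬ CutRkAtLeast G (InPrefix G σ i) (suc k)) ×
  (∀ (σ : Layout G) → ∃ λ i → CutRkAtLeast G (InPrefix G σ i) k)

-- Lower bound.  Only G₁ matters: by induction every graph in Δᵢ is connected, and every injective
-- numbering of its vertices has a prefix of cut-rank at least i + 1.  For a delta composition of
-- A, B, C let t_A ≤ t_B ≤ t_C be thresholds at which the pieces reach cut-rank i + 1.  The prefix
-- below t_B meets A and misses part of C; since B touches the rest only through its root, an edge
-- of the cut inside A or C, or else the edge between the roots of A and C, gives a row independent
-- of the i + 1 rows found in B.
--
-- Upper bound.  Every graph in Δᵢ has layouts of width at most i + 1 starting, and ending, at any
-- prescribed vertex: list the three pieces one after another, the piece of that vertex first (last).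
-- A prefix then cuts at most one piece, and the triangle adds one rank-one term.  Listing G₁ ending
-- at w₁ followed by G₂ starting at w₂ gives width k, since the edge w₁w₂ crosses only the cut that
-- separates exactly G₁ from G₂.

module Submission where

open import Defs
open import Algebra.Bundles using (CommutativeRing)
open import Data.Bool using (Bool; true; false; _∧_; _∨_; _xor_)
open import Data.Bool.Properties
  using (∨-identityʳ; xor-∧-commutativeRing; xor-comm; xor-same; xor-identityʳ; ∧-zeroʳ; ∧-identityʳ; ∧-assoc;
         ∧-distribˡ-xor; ∧-distribʳ-xor; ¬-not)
  renaming (_≟_ to _≟ᵇ_)
open import Algebra.Properties.CommutativeSemigroup
  (CommutativeRing.+-commutativeSemigroup xor-∧-commutativeRing) using (interchange)
open import Data.Fin using (Fin; zero; suc; toℕ; opposite; splitAt; _↑ˡ_; _↑ʳ_; punchIn; punchOut; _≟_)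
import Data.Fin as Fin
open import Data.Fin.Permutation using (cast-id; ↔⇒≡)
open import Data.Fin.Properties
  using (opposite-involutive; any?; punchIn-punchOut; splitAt-join; splitAt-↑ˡ; splitAt-↑ʳ; +↔⊎;
         toℕ-↑ˡ; toℕ-↑ʳ; toℕ-cast; toℕ-injective; toℕ<n; ↑ˡ-injective; ↑ʳ-injective)
open import Data.Nat using (ℕ; zero; suc; _+_; _∸_; _≤_; _<_; z≤n; s≤s; _≤′_; ≤′-refl; ≤′-step; _≤?_; _<?_)
open import Data.Nat.Properties
  using (<⇒≱; <-trans; ≤-refl; ≤-trans; <-≤-trans; ≤-<-trans; <⇒≤; ≰⇒>; m≤m+n; +-monoʳ-≤; +-monoʳ-<;
         +-assoc; n<1+n; <-cmp; ≤⇒≤′)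
open import Data.Product using (Σ; ∃; ∃₂; _×_; _,_; proj₁; proj₂)
open import Data.Sum using (_⊎_; inj₁; inj₂; [_,_]′; map₂)
open import Data.Sum.Algebra using (⊎-cong; ⊎-comm; ⊎-assoc)
open import Data.Sum.Properties using (inj₁-injective; inj₂-injective)
open import Data.Vec.Functional using (_∷_)
open import Function.Base using (_∘_; id; _⟨_⟩_)
open import Function.Bundles using (_↔_; Inverse; mk↔ₛ′)
open import Function.Definitions using (Injective)
open import Function.Properties.Inverse using (↔-refl; ↔-sym; ↔-trans)
open import Level using (0ℓ)
open import Relation.Binary using (tri<; tri≈; tri>)
open import Relation.Binary.PropositionalEquality
  using (_≡_; _≢_; refl; sym; trans; cong; cong₂; subst; subst₂; module ≡-Reasoning)
open import Relation.Nullary using (¬_; yes; no; contradiction)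
open import Relation.Nullary.Decidable using (¬?; decidable-stable)
open import Relation.Unary using (Decidable; _≐_)

-- Linear algebra over GF(2)

xorSum-cong : ∀ {r} {f g : Fin r → Bool} → (∀ j → f j ≡ g j) → xorSum f ≡ xorSum g
xorSum-cong {zero}  _   = refl
xorSum-cong {suc r} f≗g = cong₂ _xor_ (f≗g zero) (xorSum-cong (f≗g ∘ suc))

xorSum-zero : ∀ {r} {f : Fin r → Bool} → (∀ j → f j ≡ false) → xorSum f ≡ false
xorSum-zero {zero}  _   = refl
xorSum-zero {suc r} f≗0 = cong₂ _xor_ (f≗0 zero) (xorSum-zero (f≗0 ∘ suc))

xorSum-xor : ∀ {r} (f g : Fin r → Bool) → xorSum (λ j → f j xor g j) ≡ xorSum f xor xorSum g
xorSum-xor {zero}  f g = refl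
xorSum-xor {suc r} f g =
  trans (cong ((f zero xor g zero) xor_) (xorSum-xor (f ∘ suc) (g ∘ suc)))
        (interchange (f zero) (g zero) (xorSum (f ∘ suc)) (xorSum (g ∘ suc)))

xorSum-∧ˡ : ∀ {r} b (f : Fin r → Bool) → xorSum (λ j → b ∧ f j) ≡ b ∧ xorSum f
xorSum-∧ˡ {zero}  b f = sym (∧-zeroʳ b)
xorSum-∧ˡ {suc r} b f =
  trans (cong ((b ∧ f zero) xor_) (xorSum-∧ˡ b (f ∘ suc))) (sym (∧-distribˡ-xor b (f zero) (xorSum (f ∘ suc))))

xorSum-∧ʳ : ∀ {r} b (f : Fin r → Bool) → xorSum (λ j → f j ∧ b) ≡ xorSum f ∧ b
xorSum-∧ʳ {zero}  b f = refl
xorSum-∧ʳ {suc r} b f =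
  trans (cong ((f zero ∧ b) xor_) (xorSum-∧ʳ b (f ∘ suc))) (sym (∧-distribʳ-xor b (f zero) (xorSum (f ∘ suc))))

xorSum-comm : ∀ {r m} (h : Fin r → Fin m → Bool) →
              xorSum (λ j → xorSum (h j)) ≡ xorSum (λ l → xorSum (λ j → h j l))
xorSum-comm {zero} {m} h = sym (xorSum-zero {m} (λ _ → refl))
xorSum-comm {suc r} h =
  trans (cong (xorSum (h zero) xor_) (xorSum-comm (h ∘ suc))) (sym (xorSum-xor (h zero) _))

combination : ∀ {r} {I : Set} → (Fin r → Bool) → (Fin r → I → Bool) → I → Bool
combination T v i = xorSum (λ j → T j ∧ v j i)

Nonempty : ∀ {r} → (Fin r → Bool) → Set
Nonempty T = ∃ λ j → T j ≡ true

Nonempty-tail : ∀ {r} {T : Fin (suc r) → Bool} → T zero ≡ false → Nonempty T → Nonempty (T ∘ suc)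
Nonempty-tail T₀≡0 (zero  , T₀≡1) = contradiction (trans (sym T₀≡0) T₀≡1) λ ()
Nonempty-tail _    (suc j , Tj≡1) = j , Tj≡1

combination-xor : ∀ {r} {I : Set} (T : Fin r → Bool) (v v′ : Fin r → I → Bool) i →
                  combination T (λ j i → v j i xor v′ j i) i ≡ combination T v i xor combination T v′ i
combination-xor T v v′ i = trans (xorSum-cong (λ j → ∧-distribˡ-xor (T j) (v j i) (v′ j i)))
        (xorSum-xor (λ j → T j ∧ v j i) (λ j → T j ∧ v′ j i))

combination-∧ʳ : ∀ {r} {I : Set} (T : Fin r → Bool) (f : Fin r → Bool) (g : I → Bool) i →
                 combination T (λ j i → f j ∧ g i) i ≡ combination T (λ j _ → f j) i ∧ g i
combination-∧ʳ T f g i =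
  trans (xorSum-cong (λ j → sym (∧-assoc (T j) (f j) (g i)))) (xorSum-∧ʳ (g i) (λ j → T j ∧ f j))

combination-assoc : ∀ {r K} {I : Set} (T : Fin r → Bool) (ρ : Fin r → Fin K → Bool) (b : Fin K → I → Bool) i →
                    combination T (λ j → combination (ρ j) b) i ≡ combination (combination T ρ) b i
combination-assoc T ρ b i = begin
  xorSum (λ j → T j ∧ xorSum (λ l → ρ j l ∧ b l i))
    ≡⟨ xorSum-cong (λ j → sym (xorSum-∧ˡ (T j) (λ l → ρ j l ∧ b l i))) ⟩
  xorSum (λ j → xorSum (λ l → T j ∧ (ρ j l ∧ b l i)))
    ≡⟨ xorSum-comm (λ j l → T j ∧ (ρ j l ∧ b l i)) ⟩
  xorSum (λ l → xorSum (λ j → T j ∧ (ρ j l ∧ b l i)))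
    ≡⟨ xorSum-cong (λ l → combination-∧ʳ T (λ j → ρ j l) (b l) i) ⟩
  xorSum (λ l → combination T ρ l ∧ b l i)
    ∎
  where open ≡-Reasoning

clearColumn : ∀ {r m} → Fin m → (Fin (suc r) → Fin m → Bool) → Fin r → Fin m → Bool
clearColumn l₀ c j l = c (suc j) l xor (c (suc j) l₀ ∧ c zero l)

-- Gaussian elimination: a pivot in row 0 clears its column from the other rows, leaving
-- suc m rows in m coordinates
dependent : ∀ m (c : Fin (suc m) → Fin m → Bool) →
            ∃ λ T → Nonempty T × ∀ l → combination T c l ≡ false
dependent m c with any? (λ l → c zero l ≟ᵇ true)
... | no c₀≡0 = (true ∷ λ _ → false) , (zero , refl) , first-row-zero
  where
  first-row-zero : ∀ l → combination (true ∷ λ _ → false) c l ≡ false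
  first-row-zero l = cong₂ _xor_ (¬-not (λ c₀l → c₀≡0 (l , c₀l))) (xorSum-zero {m} (λ _ → refl))
dependent zero    c | yes (() , _)
dependent (suc m) c | yes (l₀ , pivot) with dependent m (λ j l → clearColumn l₀ c j (punchIn l₀ l))
... | T′ , T′≢0 , T′c≡0 = (s ∷ T′) , (suc (proj₁ T′≢0) , proj₂ T′≢0) , eliminated
  where
  s : Bool
  s = combination T′ (c ∘ suc) l₀

  cleared≡0 : ∀ l → combination T′ (clearColumn l₀ c) l ≡ false
  cleared≡0 l with l₀ ≟ l
  ... | yes refl = xorSum-zero λ j → let x = c (suc j) l₀ in begin
    T′ j ∧ (x xor (x ∧ c zero l₀)) ≡⟨ cong (λ b → T′ j ∧ (x xor (x ∧ b))) pivot ⟩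
    T′ j ∧ (x xor (x ∧ true))      ≡⟨ cong (λ b → T′ j ∧ (x xor b)) (∧-identityʳ x) ⟩
    T′ j ∧ (x xor x)               ≡⟨ cong (T′ j ∧_) (xor-same x) ⟩
    T′ j ∧ false                   ≡⟨ ∧-zeroʳ (T′ j) ⟩
    false                          ∎
    where open ≡-Reasoning
  ... | no l₀≢l = subst (λ l → combination T′ (clearColumn l₀ c) l ≡ false)
                        (punchIn-punchOut l₀≢l) (T′c≡0 (punchOut l₀≢l))

  eliminated : ∀ l → combination (s ∷ T′) c l ≡ false
  eliminated l = begin
    (s ∧ c zero l) xor combination T′ (c ∘ suc) l
      ≡⟨ xor-comm (s ∧ c zero l) _ ⟩
    combination T′ (c ∘ suc) l xor (s ∧ c zero l)
      ≡⟨ cong (combination T′ (c ∘ suc) l xor_) (sym (combination-∧ʳ T′ (λ j → c (suc j) l₀) (c zero) l)) ⟩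
    combination T′ (c ∘ suc) l xor combination T′ (λ j l → c (suc j) l₀ ∧ c zero l) l
      ≡⟨ sym (combination-xor T′ (c ∘ suc) (λ j l → c (suc j) l₀ ∧ c zero l) l) ⟩
    combination T′ (clearColumn l₀ c) l
      ≡⟨ cleared≡0 l ⟩
    false ∎
    where open ≡-Reasoning

-- Cut-rank

-- cutrk_G(X) ≤ K, witnessed by a factorisation of A[X, V∖X] into K rank-one terms
CutRkAtMost : (G : Graph) → (Fin (n G) → Set) → ℕ → Set
CutRkAtMost G X K =
  Σ (Fin K → Fin (n G) → Bool) λ a → Σ (Fin K → Fin (n G) → Bool) λ b →
    ∀ x w → X x → ¬ X w → adj G x w ≡ combination (λ l → a l x) b w

CutRkAtMost⇒¬CutRkAtLeast : ∀ {G X K} → CutRkAtMost G X K → ¬ CutRkAtLeast G X (suc K)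
CutRkAtMost⇒¬CutRkAtLeast {G} {X} {K} (a , b , factorisation) (u , u∈X , independent)
  with dependent K (λ j l → a l (u j))
... | T , T≢0 , Tρ≡0 with independent T T≢0
... | w , w∉X , Tu≡1 = false≢true (begin
  false
    ≡⟨ sym (xorSum-zero (λ l → cong (_∧ b l w) (Tρ≡0 l))) ⟩
  combination (combination T (λ j l → a l (u j))) b w
    ≡⟨ sym (combination-assoc T (λ j l → a l (u j)) b w) ⟩
  combination T (λ j → combination (λ l → a l (u j)) b) w
    ≡⟨ xorSum-cong (λ j → cong (T j ∧_) (sym (factorisation (u j) w (u∈X j) w∉X))) ⟩
  combination T (adj G ∘ u) w
    ≡⟨ Tu≡1 ⟩
  true
    ∎)
  where
  open ≡-Reasoning
  false≢true : false ≢ true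
  false≢true ()

CutRkAtMost-suc : ∀ {G X K} → CutRkAtMost G X K → CutRkAtMost G X (suc K)
CutRkAtMost-suc (a , b , factorisation) = ((λ _ → false) ∷ a) , ((λ _ → false) ∷ b) , factorisation

CutRkAtMost-mono : ∀ {G X K K′} → K ≤′ K′ → CutRkAtMost G X K → CutRkAtMost G X K′
CutRkAtMost-mono ≤′-refl          = id
CutRkAtMost-mono {G} {X} (≤′-step K≤′K′) = CutRkAtMost-suc {G} {X} ∘ CutRkAtMost-mono {G} {X} K≤′K′

CutRkAtMost-cong : ∀ {G X Y K} → X ≐ Y → CutRkAtMost G X K → CutRkAtMost G Y K
CutRkAtMost-cong (X⊆Y , Y⊆X) (a , b , factorisation) =
  a , b , λ x w y∈Y w∉Y → factorisation x w (Y⊆X y∈Y) (w∉Y ∘ X⊆Y)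

IndependentOn : (G : Graph) (X W : Fin (n G) → Set) {r : ℕ} → (Fin r → Fin (n G)) → Set
IndependentOn G X W u =
  ∀ T → Nonempty T → ∃ λ w → ¬ X w × W w × combination T (adj G ∘ u) w ≡ true

module Extend {G : Graph} {X W : Fin (n G) → Set} {r : ℕ} {u : Fin r → Fin (n G)}
              (u∈X : ∀ j → X (u j)) (independent : IndependentOn G X W u)
              {x y : Fin (n G)} (x∈X : X x) (y∉X : ¬ X y) (xy : adj G x y ≡ true) where

  private
    rows : Fin (suc r) → Fin (n G)
    rows = x ∷ u

    rows∈X : ∀ j → X (rows j)
    rows∈X zero    = x∈X
    rows∈X (suc j) = u∈X j

    Witness : (Fin (suc r) → Bool) → Set
    Witness T = ∃ λ w → ¬ X w × combination T (adj G ∘ rows) w ≡ true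

    from-tail : ∀ T → Nonempty (T ∘ suc) → T zero ≡ false → Witness T
    from-tail T tail≢0 T₀≡0 with independent (T ∘ suc) tail≢0
    ... | w , w∉X , _ , tail≡1 =
      w , w∉X , trans (cong (λ t → (t ∧ adj G x w) xor combination (T ∘ suc) (adj G ∘ u) w) T₀≡0) tail≡1

    at-y : ∀ T → T zero ≡ true → combination (T ∘ suc) (adj G ∘ u) y ≡ false → Witness T
    at-y T T₀≡1 tail≡0 =
      y , y∉X , trans (cong₂ (λ t s → (t ∧ adj G x y) xor s) T₀≡1 tail≡0) (cong (_xor false) xy)

  by-private-column : (∀ j → adj G (u j) y ≡ false) → CutRkAtLeast G X (suc r)
  by-private-column uy≡0 = rows , rows∈X , witness
    where
    witness : ∀ T → Nonempty T → Witness T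
    witness T T≢0 with T zero ≟ᵇ true
    ... | yes T₀ = at-y T T₀ (xorSum-zero (λ j → trans (cong (T (suc j) ∧_) (uy≡0 j)) (∧-zeroʳ _)))
    ... | no T₀  = from-tail T (Nonempty-tail (¬-not T₀) T≢0) (¬-not T₀)

  by-private-row : (∀ w → ¬ X w → W w → adj G x w ≡ false) → CutRkAtLeast G X (suc r)
  by-private-row xW≡0 = rows , rows∈X , witness
    where
    witness : ∀ T → Nonempty T → Witness T
    witness T T≢0 with T zero ≟ᵇ true
    ... | no T₀ = from-tail T (Nonempty-tail (¬-not T₀) T≢0) (¬-not T₀)
    ... | yes T₀ with any? (λ j → T (suc j) ≟ᵇ true)
    ...   | no tail≡0 = at-y T T₀ (xorSum-zero (λ j → cong (_∧ adj G (u j) y) (¬-not (λ t → tail≡0 (j , t)))))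
    ...   | yes tail≢0 with independent (T ∘ suc) tail≢0
    ...     | w , w∉X , w∈W , tail≡1 =
              w , w∉X , trans (cong₂ (λ t s → (t ∧ adj G x w) xor s) T₀ tail≡1)
                              (cong (_xor true) (xW≡0 w w∉X w∈W))

-- Graphs, embeddings and layouts

==-refl : ∀ {m} (x : Fin m) → (x == x) ≡ true
==-refl x with x ≟ x
... | yes _   = refl
... | no x≢x = contradiction refl x≢x

==-≢ : ∀ {m} {x y : Fin m} → x ≢ y → (x == y) ≡ false
==-≢ {x = x} {y} x≢y with x ≟ y
... | yes x≡y = contradiction x≡y x≢y
... | no _    = refl

==-injective : ∀ {m k} {f : Fin m → Fin k} → Injective _≡_ _≡_ f → ∀ x y → (f x == f y) ≡ (x == y)
==-injective {f = f} f-inj x y with x ≟ y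
... | yes refl = ==-refl (f x)
... | no x≢y   = ==-≢ (x≢y ∘ f-inj)

==-apart : ∀ {m} {x y : Fin m} (z : Fin m) → x ≢ y → (x == z) ∧ (y == z) ≡ false
==-apart {x = x} {y} z x≢y with x ≟ z
... | yes refl = ==-≢ (x≢y ∘ sym)
... | no _     = refl

↑ˡ≢↑ʳ : ∀ {m k} (x : Fin m) (y : Fin k) → x ↑ˡ k ≢ m ↑ʳ y
↑ˡ≢↑ʳ {m} {k} x y x≡y with trans (sym (splitAt-↑ˡ m x k)) (trans (cong (splitAt m) x≡y) (splitAt-↑ʳ m k y))
... | ()

↔-to-injective : ∀ {A B : Set} (f : A ↔ B) → Injective _≡_ _≡_ (Inverse.to f)
↔-to-injective f {x} {y} fx≡fy =
  trans (sym (Inverse.strictlyInverseʳ f x)) (trans (cong (Inverse.from f) fx≡fy) (Inverse.strictlyInverseʳ f y))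

∀-↔ : ∀ {A B : Set} (f : A ↔ B) {P : B → Set} → (∀ a → P (Inverse.to f a)) → ∀ b → P b
∀-↔ f {P} P∘f b = subst P (Inverse.strictlyInverseˡ f b) (P∘f (Inverse.from f b))

join-adj : ∀ G H p q u v →
           adj (join G H p q) (Fin.join (n G) (n H) u) (Fin.join (n G) (n H) v) ≡ joinAdj G H p q u v
join-adj G H p q u v rewrite splitAt-join (n G) (n H) u | splitAt-join (n G) (n H) v = refl

CrossingEdge : (G : Graph) → (Fin (n G) → Set) → Set
CrossingEdge G X = ∃₂ λ x y → X x × ¬ X y × adj G x y ≡ true

Connected : Graph → Set₁
Connected G = ∀ {X : Fin (n G) → Set} → Decidable X → (∃ λ x → X x) → (∃ λ y → ¬ X y) → CrossingEdge G X

adjacent-crossing : ∀ {G X x y} → adj G x y ≡ true → (X x × ¬ X y) ⊎ (¬ X x × X y) → CrossingEdge G X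
adjacent-crossing {x = x} {y} xy (inj₁ (x∈X , y∉X)) = x , y , x∈X , y∉X , xy
adjacent-crossing {G} {x = x} {y} xy (inj₂ (x∉X , y∈X)) = y , x , y∈X , x∉X , trans (adj-sym G y x) xy

module _ {G : Graph} (connected : Connected G) {X : Fin (n G) → Set} (X? : Decidable X) where

  inside-or-crossing : (∃ λ x → X x) → (∀ y → X y) ⊎ CrossingEdge G X
  inside-or-crossing x∈X with any? (¬? ∘ X?)
  ... | yes y∉X  = inj₂ (connected X? x∈X y∉X)
  ... | no ∄y∉X = inj₁ (λ y → decidable-stable (X? y) (λ y∉X → ∄y∉X (y , y∉X)))

  outside-or-crossing : (∃ λ y → ¬ X y) → (∀ x → ¬ X x) ⊎ CrossingEdge G X
  outside-or-crossing y∉X with any? X?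
  ... | yes x∈X  = inj₂ (connected X? x∈X y∉X)
  ... | no ∄x∈X = inj₁ (λ x x∈X → ∄x∈X (x , x∈X))

-- stated for injective numberings rather than layouts so that it passes to induced subgraphs
LinRkAtLeast : Graph → ℕ → Set
LinRkAtLeast G r =
  ∀ (pos : Fin (n G) → ℕ) → Injective _≡_ _≡_ pos → ∃ λ t → CutRkAtLeast G (λ x → pos x < t) r

edge⇒cutRkAtLeast-one : ∀ {G} (pos : Fin (n G) → ℕ) {x y} → adj G x y ≡ true → pos x < pos y →
                         CutRkAtLeast G (λ z → pos z < suc (pos x)) 1
edge⇒cutRkAtLeast-one {G} pos {x} {y} xy x<y = (λ _ → x) , (λ _ → n<1+n (pos x)) , witness
  where
  witness : ∀ T → Nonempty T → ∃ λ w → ¬ pos w < suc (pos x) × combination T (λ _ → adj G x) w ≡ true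
  witness T (zero , T₀≡1) =
    y , (λ { (s≤s y≤x) → <⇒≱ x<y y≤x }) ,
    cong (_xor false) (cong₂ _∧_ T₀≡1 xy)

record Embedding (H G : Graph) : Set where
  field
    map       : Fin (n H) → Fin (n G)
    injective : Injective _≡_ _≡_ map
    adj-map   : ∀ x y → adj G (map x) (map y) ≡ adj H x y

module _ {H G : Graph} (e : Embedding H G) where
  open Embedding e

  embed-crossingEdge : ∀ {X} → CrossingEdge H (X ∘ map) → CrossingEdge G X
  embed-crossingEdge (x , y , x∈X , y∉X , xy) = map x , map y , x∈X , y∉X , trans (adj-map x y) xy

  embed-rows : ∀ {X r} (rows : CutRkAtLeast H (X ∘ map) r) →
               IndependentOn G X (λ w → ∃ λ y → map y ≡ w) (map ∘ proj₁ rows)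
  embed-rows (u , _ , independent) T T≢0 with independent T T≢0
  ... | w , w∉X , Tu≡1 =
    map w , w∉X , (w , refl) , trans (xorSum-cong (λ j → cong (T j ∧_) (adj-map (u j) w))) Tu≡1

  embed-cutRkAtLeast : ∀ {X r} → CutRkAtLeast H (X ∘ map) r → CutRkAtLeast G X r
  embed-cutRkAtLeast {X} rows@(u , u∈X , _) = map ∘ u , u∈X , witness
    where
    witness : ∀ T → Nonempty T → ∃ λ w → ¬ X w × combination T (adj G ∘ map ∘ u) w ≡ true
    witness T T≢0 with embed-rows rows T T≢0
    ... | w , w∉X , _ , Tu≡1 = w , w∉X , Tu≡1

  embed-linRkAtLeast : ∀ {r} → LinRkAtLeast H r → LinRkAtLeast G r
  embed-linRkAtLeast lrH pos pos-inj with lrH (pos ∘ map) (injective ∘ pos-inj)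
  ... | t , rows = t , embed-cutRkAtLeast rows

  pullback-cutRkAtMost : ∀ {X K} → CutRkAtMost G X K → CutRkAtMost H (X ∘ map) K
  pullback-cutRkAtMost (a , b , factorisation) =
    (λ l → a l ∘ map) , (λ l → b l ∘ map) ,
    λ x w x∈X w∉X → trans (sym (adj-map x w)) (factorisation (map x) (map w) x∈X w∉X)

position : ∀ {N} → Fin N ↔ Fin N → Fin N → ℕ
position σ = toℕ ∘ Inverse.from σ

position-injective : ∀ {N} (σ : Fin N ↔ Fin N) → Injective _≡_ _≡_ (position σ)
position-injective σ = ↔-to-injective (↔-sym σ) ∘ toℕ-injective

_⊕_ : ∀ {m k} → Fin m ↔ Fin m → Fin k ↔ Fin k → Fin (m + k) ↔ Fin (m + k)
σ ⊕ τ = ↔-trans +↔⊎ (↔-trans (⊎-cong σ τ) (↔-sym +↔⊎))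

position-⊕-↑ˡ : ∀ {m k} (σ : Fin m ↔ Fin m) (τ : Fin k ↔ Fin k) x →
                position (σ ⊕ τ) (x ↑ˡ k) ≡ position σ x
position-⊕-↑ˡ {m} {k} σ τ x rewrite splitAt-↑ˡ m x k = toℕ-↑ˡ (Inverse.from σ x) k

position-⊕-↑ʳ : ∀ {m k} (σ : Fin m ↔ Fin m) (τ : Fin k ↔ Fin k) y →
                position (σ ⊕ τ) (m ↑ʳ y) ≡ m + position τ y
position-⊕-↑ʳ {m} {k} σ τ y rewrite splitAt-↑ʳ m k y = toℕ-↑ʳ m (Inverse.from τ y)

relabel : ∀ {M N} → Fin M ↔ Fin N → Fin N ↔ Fin N → Fin M ↔ Fin M
relabel f σ = ↔-trans (cast-id (↔⇒≡ f)) (↔-trans σ (↔-sym f))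

position-relabel : ∀ {M N} (f : Fin M ↔ Fin N) σ z → position (relabel f σ) z ≡ position σ (Inverse.to f z)
position-relabel f σ z = toℕ-cast _ (Inverse.from σ (Inverse.to f z))

WidthAtMost : (G : Graph) → Layout G → ℕ → Set
WidthAtMost G σ K = ∀ t → CutRkAtMost G (InPrefix G σ t) K

LayoutStartingAt : (G : Graph) → ℕ → Fin (n G) → Set
LayoutStartingAt G K v = Σ (Layout G) λ σ → WidthAtMost G σ K × ∀ x → position σ v ≤ position σ x

LayoutEndingAt : (G : Graph) → ℕ → Fin (n G) → Set
LayoutEndingAt G K v = Σ (Layout G) λ σ → WidthAtMost G σ K × ∀ x → position σ x ≤ position σ v

EndpointLayouts : Graph → ℕ → Set
EndpointLayouts G K = ∀ v → LayoutStartingAt G K v × LayoutEndingAt G K v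

module _ {G H : Graph} (G≅H : G ≅ H) where
  private
    f : Fin (n G) ↔ Fin (n H)
    f = proj₁ G≅H

  ≅⇒embedding : Embedding G H
  ≅⇒embedding = record { map = Inverse.to f ; injective = ↔-to-injective f ; adj-map = proj₂ G≅H }

  ≅⇒embedding⁻¹ : Embedding H G
  ≅⇒embedding⁻¹ = record
    { map       = Inverse.from f
    ; injective = ↔-to-injective (↔-sym f)
    ; adj-map   = λ x y → trans (sym (proj₂ G≅H _ _))
                                (cong₂ (adj H) (Inverse.strictlyInverseˡ f x) (Inverse.strictlyInverseˡ f y))
    }

  Connected-≅ : Connected H → Connected G
  Connected-≅ connected {X} X? (x , x∈X) (y , y∉X) =
    embed-crossingEdge ≅⇒embedding⁻¹
      (connected (X? ∘ Inverse.from f)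
        (Inverse.to f x , subst X (sym (Inverse.strictlyInverseʳ f x)) x∈X)
        (Inverse.to f y , y∉X ∘ subst X (Inverse.strictlyInverseʳ f y)))

  WidthAtMost-relabel : ∀ {K} σ → WidthAtMost H σ K → WidthAtMost G (relabel f σ) K
  WidthAtMost-relabel {K} σ width t =
    CutRkAtMost-cong {G} {InPrefix H σ t ∘ Inverse.to f}
      ((λ {x} → subst (_< t) (sym (position-relabel f σ x))) , λ {x} → subst (_< t) (position-relabel f σ x))
      (pullback-cutRkAtMost ≅⇒embedding {InPrefix H σ t} {K} (width t))

  EndpointLayouts-≅ : ∀ {K} → EndpointLayouts H K → EndpointLayouts G K
  EndpointLayouts-≅ layouts v with layouts (Inverse.to f v)
  ... | (σ , width , starts) , (τ , width′ , ends) =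
    (relabel f σ , WidthAtMost-relabel σ width ,
     λ x → subst₂ _≤_ (sym (position-relabel f σ v)) (sym (position-relabel f σ x)) (starts (Inverse.to f x))) ,
    (relabel f τ , WidthAtMost-relabel τ width′ ,
     λ x → subst₂ _≤_ (sym (position-relabel f τ x)) (sym (position-relabel f τ v)) (ends (Inverse.to f x)))

-- Cuts of joins

+<⇒<∸ : ∀ o {p t} → o + p < t → p < t ∸ o
+<⇒<∸ zero              p<t          = p<t
+<⇒<∸ (suc o) {t = zero}  ()
+<⇒<∸ (suc o) {t = suc t} (s≤s o+p<t) = +<⇒<∸ o o+p<t

<∸⇒+< : ∀ o {p t} → p < t ∸ o → o + p < t
<∸⇒+< zero              p<t   = p<t
<∸⇒+< (suc o) {t = zero}  ()
<∸⇒+< (suc o) {t = suc t} p<t∸o = s≤s (<∸⇒+< o p<t∸o)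

prefix-shift : ∀ {m} {f g : Fin m → ℕ} o t → (∀ z → f z ≡ o + g z) →
               (λ z → g z < t ∸ o) ≐ (λ z → f z < t)
prefix-shift o t f≡o+g =
  (λ {z} gz<t∸o → subst (_< t) (sym (f≡o+g z)) (<∸⇒+< o gz<t∸o)) ,
  (λ {z} fz<t → +<⇒<∸ o (subst (_< t) (f≡o+g z) fz<t))

Monochromatic : ∀ {m} {V : Set} → (V → Set) → (Fin m → V) → Set
Monochromatic X f = (∀ y → X (f y)) ⊎ (∀ y → ¬ X (f y))

Monochromatic⇒closed : ∀ {m} {V : Set} {X : V → Set} {f : Fin m → V} →
                       Monochromatic X f → ∀ {x y} → X (f x) → X (f y)
Monochromatic⇒closed (inj₁ inside)  _   = inside _
Monochromatic⇒closed (inj₂ outside) fx∈X = contradiction fx∈X (outside _)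

FactorsVia : (G : Graph) {S : Set} → (S ↔ Fin (n G)) → (Fin (n G) → Set) →
             ∀ {K} → (a b : Fin K → S → Bool) → Set
FactorsVia G f X a b =
  ∀ u v → X (Inverse.to f u) → ¬ X (Inverse.to f v) →
    adj G (Inverse.to f u) (Inverse.to f v) ≡ combination (λ l → a l u) b v

CutRkAtMost-via : ∀ {G X K} {S : Set} (f : S ↔ Fin (n G)) (a b : Fin K → S → Bool) →
                  FactorsVia G f X a b → CutRkAtMost G X K
CutRkAtMost-via {G} {X} f a b factorisation =
  (λ l → a l ∘ Inverse.from f) , (λ l → b l ∘ Inverse.from f) ,
  λ z w z∈X w∉X →
    subst₂ (λ z′ w′ → adj G z′ w′ ≡ combination (λ l → a l (Inverse.from f z)) b (Inverse.from f w))
           (inverse z) (inverse w)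
           (factorisation _ _ (subst X (sym (inverse z)) z∈X) (w∉X ∘ subst X (inverse w)))
  where
  inverse : ∀ z → Inverse.to f (Inverse.from f z) ≡ z
  inverse = Inverse.strictlyInverseˡ f

module _ (G H : Graph) (p : Fin (n G) → Bool) (q : Fin (n H) → Bool) {X : Fin (n G + n H) → Set} where
  private
    J : Graph
    J = join G H p q

    split : (Fin (n G) ⊎ Fin (n H)) ↔ Fin (n G + n H)
    split = ↔-sym +↔⊎

  join-cutRkAtMost-left : ∀ {K} → (∀ y → ¬ X (n G ↑ʳ y)) → (∀ x → X (x ↑ˡ n H) → p x ≡ false) →
                          CutRkAtMost G (λ x → X (x ↑ˡ n H)) K → CutRkAtMost J X K
  join-cutRkAtMost-left {K} H∩X≡∅ p≡0 (a , b , factorisation) =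
    CutRkAtMost-via {J} {X} split α β check
    where
    α β : Fin K → Fin (n G) ⊎ Fin (n H) → Bool
    α l = [ a l , (λ _ → false) ]′
    β l = [ b l , (λ _ → false) ]′
    check : FactorsVia J split X α β
    check (inj₁ x) (inj₁ y) x∈X y∉X = trans (join-adj G H p q (inj₁ x) (inj₁ y)) (factorisation x y x∈X y∉X)
    check (inj₁ x) (inj₂ y) x∈X _   =
      trans (join-adj G H p q (inj₁ x) (inj₂ y))
            (trans (cong (_∧ q y) (p≡0 x x∈X)) (sym (xorSum-zero (λ l → ∧-zeroʳ (a l x)))))
    check (inj₂ x) _        x∈X _   = contradiction x∈X (H∩X≡∅ x)

  join-cutRkAtMost-right : ∀ {K} → (∀ x → X (x ↑ˡ n H)) → (∀ y → ¬ X (n G ↑ʳ y) → q y ≡ false) →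
                           CutRkAtMost H (λ y → X (n G ↑ʳ y)) K → CutRkAtMost J X K
  join-cutRkAtMost-right {K} G⊆X q≡0 (a , b , factorisation) =
    CutRkAtMost-via {J} {X} split α β check
    where
    α β : Fin K → Fin (n G) ⊎ Fin (n H) → Bool
    α l = [ (λ _ → false) , a l ]′
    β l = [ (λ _ → false) , b l ]′
    check : FactorsVia J split X α β
    check (inj₂ x) (inj₂ y) x∈X y∉X = trans (join-adj G H p q (inj₂ x) (inj₂ y)) (factorisation x y x∈X y∉X)
    check (inj₁ x) (inj₂ y) _   y∉X =
      trans (join-adj G H p q (inj₁ x) (inj₂ y))
            (trans (cong (p x ∧_) (q≡0 y y∉X)) (trans (∧-zeroʳ (p x)) (sym (xorSum-zero {K} (λ _ → refl)))))
    check _        (inj₁ y) _   y∉X = contradiction (G⊆X y) y∉X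

  join-cutRkAtMost-one : (∀ x → X (x ↑ˡ n H)) → (∀ y → ¬ X (n G ↑ʳ y)) → CutRkAtMost J X 1
  join-cutRkAtMost-one G⊆X H∩X≡∅ =
    CutRkAtMost-via {J} {X} split α β check
    where
    α β : Fin 1 → Fin (n G) ⊎ Fin (n H) → Bool
    α l = [ p , (λ _ → false) ]′
    β l = [ (λ _ → false) , q ]′
    check : FactorsVia J split X α β
    check (inj₁ x) (inj₂ y) _   _   = trans (join-adj G H p q (inj₁ x) (inj₂ y)) (sym (xor-identityʳ _))
    check _        (inj₁ y) _   y∉X = contradiction (G⊆X y) y∉X
    check (inj₂ x) _        x∈X _   = contradiction x∈X (H∩X≡∅ x)

module _ {G₁ G₂ : Graph} (w₁ : Fin (n G₁)) (w₂ : Fin (n G₂)) {K : ℕ} {σ₁ : Layout G₁} {σ₂ : Layout G₂}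
         (width₁ : WidthAtMost G₁ σ₁ (suc K)) (ends : ∀ x → position σ₁ x ≤ position σ₁ w₁)
         (width₂ : WidthAtMost G₂ σ₂ (suc K)) (starts : ∀ y → position σ₂ w₂ ≤ position σ₂ y) where
  private
    n₁ n₂ : ℕ
    n₁ = n G₁
    n₂ = n G₂

    P : Fin (n₁ + n₂) → ℕ
    P = position (σ₁ ⊕ σ₂)

    Prefix : ℕ → Fin (n₁ + n₂) → Set
    Prefix = InPrefix (edgeJoin G₁ G₂ w₁ w₂) (σ₁ ⊕ σ₂)

    P-left : ∀ x → P (x ↑ˡ n₂) ≡ position σ₁ x
    P-left = position-⊕-↑ˡ σ₁ σ₂

    P-right : ∀ y → P (n₁ ↑ʳ y) ≡ n₁ + position σ₂ y
    P-right = position-⊕-↑ʳ σ₁ σ₂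

    G₁-inside : ∀ {t} → position σ₁ w₁ < t → ∀ x → P (x ↑ˡ n₂) < t
    G₁-inside {t} w₁∈X x = subst (_< t) (sym (P-left x)) (≤-<-trans (ends x) w₁∈X)

  edgeJoin-width : WidthAtMost (edgeJoin G₁ G₂ w₁ w₂) (σ₁ ⊕ σ₂) (suc K)
  edgeJoin-width t with position σ₁ w₁ <? t | n₁ + position σ₂ w₂ <? t
  ... | no w₁∉X | _ =
    join-cutRkAtMost-left G₁ G₂ (_== w₁) (_== w₂) {Prefix t} G₂-outside w₁-outside
      (CutRkAtMost-cong {G₁} (prefix-shift 0 t P-left) (width₁ t))
    where
    G₂-outside : ∀ y → ¬ P (n₁ ↑ʳ y) < t
    G₂-outside y y∈X = w₁∉X (<-trans (toℕ<n _) (≤-<-trans (m≤m+n n₁ _) (subst (_< t) (P-right y) y∈X)))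
    w₁-outside : ∀ x → P (x ↑ˡ n₂) < t → (x == w₁) ≡ false
    w₁-outside x x∈X = ==-≢ λ { refl → w₁∉X (subst (_< t) (P-left x) x∈X) }
  ... | yes w₁∈X | yes w₂∈X =
    join-cutRkAtMost-right G₁ G₂ (_== w₁) (_== w₂) {Prefix t} (G₁-inside w₁∈X) w₂-inside
      (CutRkAtMost-cong {G₂} (prefix-shift n₁ t P-right) (width₂ (t ∸ n₁)))
    where
    w₂-inside : ∀ y → ¬ P (n₁ ↑ʳ y) < t → (y == w₂) ≡ false
    w₂-inside y y∉X = ==-≢ λ { refl → y∉X (subst (_< t) (sym (P-right y)) w₂∈X) }
  ... | yes w₁∈X | no w₂∉X =
    CutRkAtMost-mono {edgeJoin G₁ G₂ w₁ w₂} {Prefix t} (≤⇒≤′ (s≤s z≤n))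
      (join-cutRkAtMost-one G₁ G₂ (_== w₁) (_== w₂) {Prefix t} (G₁-inside w₁∈X) G₂-outside)
    where
    G₂-outside : ∀ y → ¬ P (n₁ ↑ʳ y) < t
    G₂-outside y y∈X = w₂∉X (≤-<-trans (+-monoʳ-≤ n₁ (starts y)) (subst (_< t) (P-right y) y∈X))

join-embeddingˡ : ∀ G H p q → Embedding G (join G H p q)
join-embeddingˡ G H p q = record
  { map       = _↑ˡ n H
  ; injective = ↑ˡ-injective (n H) _ _
  ; adj-map   = λ x y → join-adj G H p q (inj₁ x) (inj₁ y)
  }

-- Delta compositions

⊎³↔+ : ∀ {p q r} → (Fin p ⊎ Fin q ⊎ Fin r) ↔ Fin (p + (q + r))
⊎³↔+ = ↔-trans (⊎-cong ↔-refl (↔-sym +↔⊎)) (↔-sym +↔⊎)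

Parts : Graph → Graph → Graph → Set
Parts A B C = Fin (n A) ⊎ Fin (n B) ⊎ Fin (n C)

isRoot : ∀ {A B C} → Fin (n A) → Fin (n B) → Fin (n C) → Parts A B C → Bool
isRoot a b c = [ _== a , [ _== b , _== c ]′ ]′

deltaAdj : (A B C : Graph) → Fin (n A) → Fin (n B) → Fin (n C) → Parts A B C → Parts A B C → Bool
deltaAdj A B C a b c (inj₁ x)        (inj₁ y)        = adj A x y
deltaAdj A B C a b c (inj₂ (inj₁ x)) (inj₂ (inj₁ y)) = adj B x y
deltaAdj A B C a b c (inj₂ (inj₂ x)) (inj₂ (inj₂ y)) = adj C x y
deltaAdj A B C a b c u               v               = isRoot {A} {B} {C} a b c u ∧ isRoot {A} {B} {C} a b c v

record DeltaComposition (D : Graph) : Set where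
  field
    A B C     : Graph
    a         : Fin (n A)
    b         : Fin (n B)
    c         : Fin (n C)
    parts     : Parts A B C ↔ Fin (n D)
    adj-parts : ∀ u v → adj D (Inverse.to parts u) (Inverse.to parts v) ≡ deltaAdj A B C a b c u v

  inA : Fin (n A) → Fin (n D)
  inA = Inverse.to parts ∘ inj₁

  inB : Fin (n B) → Fin (n D)
  inB = Inverse.to parts ∘ inj₂ ∘ inj₁

  inC : Fin (n C) → Fin (n D)
  inC = Inverse.to parts ∘ inj₂ ∘ inj₂

-- symmetries of the triangle: the lemmas below treat one position of a piece and reach the
-- others through these
rotate : ∀ {D} → DeltaComposition D → DeltaComposition D
rotate Δ = record
  { A = B ; B = C ; C = A ; a = b ; b = c ; c = a
  ; parts     = ↔-trans ρ parts
  ; adj-parts = λ u v → trans (adj-parts (Inverse.to ρ u) (Inverse.to ρ v)) (deltaAdj-ρ u v)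
  }
  where
  open DeltaComposition Δ
  ρ : Parts B C A ↔ Parts A B C
  ρ = ↔-trans (↔-sym (⊎-assoc 0ℓ _ _ _)) (⊎-comm _ _)
  deltaAdj-ρ : ∀ u v → deltaAdj A B C a b c (Inverse.to ρ u) (Inverse.to ρ v) ≡ deltaAdj B C A b c a u v
  deltaAdj-ρ (inj₁ x)        (inj₁ y)        = refl
  deltaAdj-ρ (inj₁ x)        (inj₂ (inj₁ y)) = refl
  deltaAdj-ρ (inj₁ x)        (inj₂ (inj₂ y)) = refl
  deltaAdj-ρ (inj₂ (inj₁ x)) (inj₁ y)        = refl
  deltaAdj-ρ (inj₂ (inj₁ x)) (inj₂ (inj₁ y)) = refl
  deltaAdj-ρ (inj₂ (inj₁ x)) (inj₂ (inj₂ y)) = refl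
  deltaAdj-ρ (inj₂ (inj₂ x)) (inj₁ y)        = refl
  deltaAdj-ρ (inj₂ (inj₂ x)) (inj₂ (inj₁ y)) = refl
  deltaAdj-ρ (inj₂ (inj₂ x)) (inj₂ (inj₂ y)) = refl

swap-BC : ∀ {D} → DeltaComposition D → DeltaComposition D
swap-BC Δ = record
  { A = A ; B = C ; C = B ; a = a ; b = c ; c = b
  ; parts     = ↔-trans τ parts
  ; adj-parts = λ u v → trans (adj-parts (Inverse.to τ u) (Inverse.to τ v)) (deltaAdj-τ u v)
  }
  where
  open DeltaComposition Δ
  τ : Parts A C B ↔ Parts A B C
  τ = ⊎-cong ↔-refl (⊎-comm _ _)
  deltaAdj-τ : ∀ u v → deltaAdj A B C a b c (Inverse.to τ u) (Inverse.to τ v) ≡ deltaAdj A C B a c b u v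
  deltaAdj-τ (inj₁ x)        (inj₁ y)        = refl
  deltaAdj-τ (inj₁ x)        (inj₂ (inj₁ y)) = refl
  deltaAdj-τ (inj₁ x)        (inj₂ (inj₂ y)) = refl
  deltaAdj-τ (inj₂ (inj₁ x)) (inj₁ y)        = refl
  deltaAdj-τ (inj₂ (inj₁ x)) (inj₂ (inj₁ y)) = refl
  deltaAdj-τ (inj₂ (inj₁ x)) (inj₂ (inj₂ y)) = refl
  deltaAdj-τ (inj₂ (inj₂ x)) (inj₁ y)        = refl
  deltaAdj-τ (inj₂ (inj₂ x)) (inj₂ (inj₁ y)) = refl
  deltaAdj-τ (inj₂ (inj₂ x)) (inj₂ (inj₂ y)) = refl

module _ {D : Graph} (Δ : DeltaComposition D) where
  open DeltaComposition Δ

  embeddingA : Embedding A D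
  embeddingA = record { map = inA ; injective = inj₁-injective ∘ ↔-to-injective parts
                      ; adj-map = λ x y → adj-parts (inj₁ x) (inj₁ y) }

  embeddingB : Embedding B D
  embeddingB = record { map = inB ; injective = inj₁-injective ∘ inj₂-injective ∘ ↔-to-injective parts
                      ; adj-map = λ x y → adj-parts (inj₂ (inj₁ x)) (inj₂ (inj₁ y)) }

  embeddingC : Embedding C D
  embeddingC = record { map = inC ; injective = inj₂-injective ∘ inj₂-injective ∘ ↔-to-injective parts
                      ; adj-map = λ x y → adj-parts (inj₂ (inj₂ x)) (inj₂ (inj₂ y)) }

  adj-roots-AB : adj D (inA a) (inB b) ≡ true
  adj-roots-AB = trans (adj-parts (inj₁ a) (inj₂ (inj₁ b))) (cong₂ _∧_ (==-refl a) (==-refl b))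

  adj-roots-AC : adj D (inA a) (inC c) ≡ true
  adj-roots-AC = trans (adj-parts (inj₁ a) (inj₂ (inj₂ c))) (cong₂ _∧_ (==-refl a) (==-refl c))

  Connected-Δ : Connected A → Connected B → Connected C → Connected D
  Connected-Δ connA connB connC {X} X? (x , x∈X) (y , y∉X) with X? (inA a) | X? (inB b) | X? (inC c)
  ... | yes a∈X | yes b∈X | yes c∈X = ∀-↔ parts {λ v → ¬ X v → CrossingEdge D X} leaves-root y y∉X
    where
    leaves-root : ∀ u → ¬ X (Inverse.to parts u) → CrossingEdge D X
    leaves-root (inj₁ x′)        x′∉X = embed-crossingEdge embeddingA (connA (X? ∘ inA) (a , a∈X) (x′ , x′∉X))
    leaves-root (inj₂ (inj₁ x′)) x′∉X = embed-crossingEdge embeddingB (connB (X? ∘ inB) (b , b∈X) (x′ , x′∉X))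
    leaves-root (inj₂ (inj₂ x′)) x′∉X = embed-crossingEdge embeddingC (connC (X? ∘ inC) (c , c∈X) (x′ , x′∉X))
  ... | yes a∈X | yes _   | no c∉X  = adjacent-crossing {D} {X} adj-roots-AC (inj₁ (a∈X , c∉X))
  ... | yes a∈X | no b∉X  | _       = adjacent-crossing {D} {X} adj-roots-AB (inj₁ (a∈X , b∉X))
  ... | no a∉X  | yes b∈X | _       = adjacent-crossing {D} {X} adj-roots-AB (inj₂ (a∉X , b∈X))
  ... | no a∉X  | no _    | yes c∈X = adjacent-crossing {D} {X} adj-roots-AC (inj₂ (a∉X , c∈X))
  ... | no a∉X  | no b∉X  | no c∉X  = ∀-↔ parts {λ v → X v → CrossingEdge D X} enters-root x x∈X
    where
    enters-root : ∀ u → X (Inverse.to parts u) → CrossingEdge D X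
    enters-root (inj₁ x′)        x′∈X = embed-crossingEdge embeddingA (connA (X? ∘ inA) (x′ , x′∈X) (a , a∉X))
    enters-root (inj₂ (inj₁ x′)) x′∈X = embed-crossingEdge embeddingB (connB (X? ∘ inB) (x′ , x′∈X) (b , b∉X))
    enters-root (inj₂ (inj₂ x′)) x′∈X = embed-crossingEdge embeddingC (connC (X? ∘ inC) (x′ , x′∈X) (c , c∉X))

  module _ {X : Fin (n D) → Set} {r : ℕ} (rowsB : CutRkAtLeast B (X ∘ inB) r) where
    private
      u : Fin r → Fin (n B)
      u = proj₁ rowsB

      u∈X : ∀ j → X (inB (u j))
      u∈X = proj₁ (proj₂ rowsB)

      module Rows = Extend {D} {X} {λ w → ∃ λ y → inB y ≡ w} {r} {inB ∘ u} u∈X (embed-rows embeddingB rowsB)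

    -- an edge of the cut inside a piece P that touches B only through the edge p b gives one more row
    crossing-beside-B : ∀ {P : Graph} (e : Embedding P D) (p : Fin (n P)) →
                        (∀ x y → adj D (Embedding.map e x) (inB y) ≡ (x == p) ∧ (y == b)) →
                        CrossingEdge P (X ∘ Embedding.map e) → CutRkAtLeast D X (suc r)
    crossing-beside-B {P} e p cross (x , y , x∈X , y∉X , xy) with y ≟ p
    ... | no y≢p = Rows.by-private-column x∈X y∉X (trans (adj-map x y) xy)
                     (λ j → trans (adj-sym D _ _) (trans (cross y (u j)) (cong (_∧ (u j == b)) (==-≢ y≢p))))
      where open Embedding e
    ... | yes refl = Rows.by-private-row x∈X y∉X (trans (adj-map x p) xy)
                       (λ { _ _ (z , refl) → trans (cross x z) (cong (_∧ (z == b)) (==-≢ x≢p)) })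
      where
      open Embedding e
      x≢p : x ≢ p
      x≢p refl = contradiction (trans (sym (irrefl P x)) xy) λ ()

    cutRkAtLeast-suc : Decidable X → Connected A → Connected C →
                       (∃ λ x → X (inA x)) → (∃ λ z → ¬ X (inC z)) → CutRkAtLeast D X (suc r)
    cutRkAtLeast-suc X? connA connC A∩X C∖X
      with inside-or-crossing {A} connA (X? ∘ inA) A∩X | outside-or-crossing {C} connC (X? ∘ inC) C∖X
    ... | inj₂ crossing | _ =
      crossing-beside-B embeddingA a (λ x y → adj-parts (inj₁ x) (inj₂ (inj₁ y))) crossing
    ... | inj₁ _ | inj₂ crossing =
      crossing-beside-B embeddingC c (λ x y → adj-parts (inj₂ (inj₂ x)) (inj₂ (inj₁ y))) crossing
    ... | inj₁ A⊆X | inj₁ C∩X≡∅ with X? (inB b)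
    ...   | yes b∈X = Rows.by-private-row (A⊆X a) (C∩X≡∅ c) adj-roots-AC
                        (λ { _ w∉X (y , refl) → trans (adj-parts (inj₁ a) (inj₂ (inj₁ y)))
                              (trans (cong (_∧ (y == b)) (==-refl a)) (==-≢ λ { refl → w∉X b∈X })) })
    ...   | no b∉X  = Rows.by-private-column (A⊆X a) (C∩X≡∅ c) adj-roots-AC
                        (λ j → trans (adj-parts (inj₂ (inj₁ (u j))) (inj₂ (inj₂ c)))
                                     (cong (_∧ (c == c)) (==-≢ λ { refl → b∉X (u∈X j) })))

  cutRkAtLeast-sorted : ∀ {r} (pos : Fin (n D) → ℕ) {tA tB tC} → tA ≤ tB → tB ≤ tC →
                        Connected A → Connected C →
                        CutRkAtLeast A (λ x → pos (inA x) < tA) (suc r) →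
                        CutRkAtLeast B (λ y → pos (inB y) < tB) (suc r) →
                        CutRkAtLeast C (λ z → pos (inC z) < tC) (suc r) →
                        CutRkAtLeast D (λ v → pos v < tB) (suc (suc r))
  cutRkAtLeast-sorted pos {tB = tB} tA≤tB tB≤tC connA connC (uA , uA∈X , _) rowsB (_ , _ , independentC) =
    cutRkAtLeast-suc rowsB (λ v → pos v <? tB) connA connC (uA zero , <-≤-trans (uA∈X zero) tA≤tB) C∖X
    where
    -- the column witnessing any nonzero combination of C's rows lies beyond t_C ≥ t_B
    C∖X : ∃ λ z → ¬ pos (inC z) < tB
    C∖X with independentC (λ _ → true) (zero , refl)
    ... | z , z∉X , _ = z , λ z∈X → z∉X (<-≤-trans z∈X tB≤tC)

  cutRkAtMost-suc : ∀ {X K} → Monochromatic X inB → Monochromatic X inC →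
                    CutRkAtMost A (X ∘ inA) K → CutRkAtMost D X (suc K)
  cutRkAtMost-suc {X} {K} monoB monoC (α , β , factorisation) =
    CutRkAtMost-via {D} {X} parts α′ β′ (λ u v u∈X v∉X → trans (adj-parts u v) (split u v u∈X v∉X))
    where
    root : Parts A B C → Bool
    root = isRoot {A} {B} {C} a b c

    α′ β′ : Fin (suc K) → Parts A B C → Bool
    α′ = root ∷ λ l → [ α l , (λ _ → false) ]′
    β′ = root ∷ λ l → [ β l , (λ _ → false) ]′

    vanishing : ∀ t {s} → s ≡ false → t ≡ t xor s
    vanishing t s≡0 = sym (trans (cong (t xor_) s≡0) (xor-identityʳ t))

    split : ∀ u v → X (Inverse.to parts u) → ¬ X (Inverse.to parts v) →
            deltaAdj A B C a b c u v ≡ combination (λ l → α′ l u) β′ v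
    split (inj₁ x) (inj₁ y) x∈X y∉X =
      trans (factorisation x y x∈X y∉X)
            (cong (_xor combination (λ l → α l x) β y) (sym (==-apart {x = x} {y} a λ { refl → y∉X x∈X })))
    split (inj₁ x)        (inj₂ (inj₁ y)) _ _ = vanishing _ (xorSum-zero (λ l → ∧-zeroʳ (α l x)))
    split (inj₁ x)        (inj₂ (inj₂ y)) _ _ = vanishing _ (xorSum-zero (λ l → ∧-zeroʳ (α l x)))
    split (inj₂ (inj₁ x)) (inj₁ y)        _ _ = vanishing _ (xorSum-zero {K} (λ _ → refl))
    split (inj₂ (inj₁ x)) (inj₂ (inj₂ y)) _ _ = vanishing _ (xorSum-zero {K} (λ _ → refl))
    split (inj₂ (inj₂ x)) (inj₁ y)        _ _ = vanishing _ (xorSum-zero {K} (λ _ → refl))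
    split (inj₂ (inj₂ x)) (inj₂ (inj₁ y)) _ _ = vanishing _ (xorSum-zero {K} (λ _ → refl))
    split (inj₂ (inj₁ x)) (inj₂ (inj₁ y)) x∈X y∉X =
      contradiction (Monochromatic⇒closed {X = X} {inB} monoB x∈X) y∉X
    split (inj₂ (inj₂ x)) (inj₂ (inj₂ y)) x∈X y∉X =
      contradiction (Monochromatic⇒closed {X = X} {inC} monoC x∈X) y∉X

  layout : Layout A → Layout B → Layout C → Layout D
  layout σA σB σC = relabel (↔-trans (↔-sym parts) ⊎³↔+) (σA ⊕ (σB ⊕ σC))

  module _ (σA : Layout A) (σB : Layout B) (σC : Layout C) where
    private
      P : Fin (n D) → ℕ
      P = position (layout σA σB σC)

      P-parts : ∀ u → P (Inverse.to parts u) ≡ position (σA ⊕ (σB ⊕ σC)) (Inverse.to ⊎³↔+ u)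
      P-parts u = trans (position-relabel (↔-trans (↔-sym parts) ⊎³↔+) (σA ⊕ (σB ⊕ σC)) (Inverse.to parts u))
                        (cong (position (σA ⊕ (σB ⊕ σC)) ∘ Inverse.to ⊎³↔+) (Inverse.strictlyInverseʳ parts u))

    position-inA : ∀ x → P (inA x) ≡ position σA x
    position-inA x = trans (P-parts (inj₁ x)) (position-⊕-↑ˡ σA (σB ⊕ σC) x)

    position-inB : ∀ y → P (inB y) ≡ n A + position σB y
    position-inB y = trans (P-parts (inj₂ (inj₁ y)))
      (trans (position-⊕-↑ʳ σA (σB ⊕ σC) (y ↑ˡ n C)) (cong (n A +_) (position-⊕-↑ˡ σB σC y)))

    position-inC : ∀ z → P (inC z) ≡ (n A + n B) + position σC z
    position-inC z = trans (P-parts (inj₂ (inj₂ z)))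
      (trans (position-⊕-↑ʳ σA (σB ⊕ σC) (n B ↑ʳ z))
             (trans (cong (n A +_) (position-⊕-↑ʳ σB σC z)) (sym (+-assoc (n A) (n B) _))))

    position-inA< : ∀ x → P (inA x) < n A
    position-inA< x = subst (_< n A) (sym (position-inA x)) (toℕ<n _)

    position-inB≥ : ∀ y → n A ≤ P (inB y)
    position-inB≥ y = subst (n A ≤_) (sym (position-inB y)) (m≤m+n _ _)

    position-inB< : ∀ y → P (inB y) < n A + n B
    position-inB< y = subst (_< n A + n B) (sym (position-inB y)) (+-monoʳ-< (n A) (toℕ<n _))

    position-inC≥ : ∀ z → n A + n B ≤ P (inC z)
    position-inC≥ z = subst (n A + n B ≤_) (sym (position-inC z)) (m≤m+n _ _)

    layout-starts : ∀ {v} → (∀ x → position σA v ≤ position σA x) → ∀ z → P (inA v) ≤ P z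
    layout-starts {v} starts = ∀-↔ parts {λ z → P (inA v) ≤ P z} λ where
      (inj₁ x)        → subst₂ _≤_ (sym (position-inA v)) (sym (position-inA x)) (starts x)
      (inj₂ (inj₁ y)) → <⇒≤ (<-≤-trans (position-inA< v) (position-inB≥ y))
      (inj₂ (inj₂ z)) → <⇒≤ (<-≤-trans (position-inA< v) (≤-trans (m≤m+n (n A) (n B)) (position-inC≥ z)))

    layout-ends : ∀ {v} → (∀ z → position σC z ≤ position σC v) → ∀ z → P z ≤ P (inC v)
    layout-ends {v} ends = ∀-↔ parts {λ z → P z ≤ P (inC v)} λ where
      (inj₁ x)        → <⇒≤ (<-≤-trans (position-inA< x) (≤-trans (m≤m+n (n A) (n B)) (position-inC≥ v)))
      (inj₂ (inj₁ y)) → <⇒≤ (<-≤-trans (position-inB< y) (position-inC≥ v))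
      (inj₂ (inj₂ z)) → subst₂ _≤_ (sym (position-inC z)) (sym (position-inC v)) (+-monoʳ-≤ (n A + n B) (ends z))

module _ {D : Graph} (Δ : DeltaComposition D) where
  open DeltaComposition Δ

  -- a prefix of the layout cuts at most one of the three pieces; rotate that piece into position A
  layout-width : ∀ {K σA σB σC} → WidthAtMost A σA K → WidthAtMost B σB K → WidthAtMost C σC K →
                 WidthAtMost D (layout Δ σA σB σC) (suc K)
  layout-width {K} {σA} {σB} {σC} widthA widthB widthC t with t ≤? n A | t ≤? n A + n B
  ... | yes t≤A | _ =
    cutRkAtMost-suc Δ (inj₂ B-outside) (inj₂ (C-outside (≤-trans t≤A (m≤m+n (n A) (n B)))))
      (CutRkAtMost-cong {A} (prefix-shift 0 t (position-inA Δ σA σB σC)) (widthA t))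
    where
    B-outside : ∀ y → ¬ position (layout Δ σA σB σC) (inB y) < t
    B-outside y y∈X = <⇒≱ (<-≤-trans y∈X t≤A) (position-inB≥ Δ σA σB σC y)
    C-outside : t ≤ n A + n B → ∀ z → ¬ position (layout Δ σA σB σC) (inC z) < t
    C-outside t≤AB z z∈X = <⇒≱ (<-≤-trans z∈X t≤AB) (position-inC≥ Δ σA σB σC z)
  ... | no t≰A | yes t≤AB =
    cutRkAtMost-suc (rotate Δ) (inj₂ C-outside) (inj₁ A-inside)
      (CutRkAtMost-cong {B} (prefix-shift (n A) t (position-inB Δ σA σB σC)) (widthB (t ∸ n A)))
    where
    A-inside : ∀ x → position (layout Δ σA σB σC) (inA x) < t
    A-inside x = <-trans (position-inA< Δ σA σB σC x) (≰⇒> t≰A)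
    C-outside : ∀ z → ¬ position (layout Δ σA σB σC) (inC z) < t
    C-outside z z∈X = <⇒≱ (<-≤-trans z∈X t≤AB) (position-inC≥ Δ σA σB σC z)
  ... | no t≰A | no t≰AB =
    cutRkAtMost-suc (rotate (rotate Δ)) (inj₁ A-inside) (inj₁ B-inside)
      (CutRkAtMost-cong {C} (prefix-shift (n A + n B) t (position-inC Δ σA σB σC)) (widthC (t ∸ (n A + n B))))
    where
    A-inside : ∀ x → position (layout Δ σA σB σC) (inA x) < t
    A-inside x = <-trans (position-inA< Δ σA σB σC x) (≰⇒> t≰A)
    B-inside : ∀ y → position (layout Δ σA σB σC) (inB y) < t
    B-inside y = <-trans (position-inB< Δ σA σB σC y) (≰⇒> t≰AB)

  layout-starting-at-A : ∀ {K} → EndpointLayouts A K → EndpointLayouts B K → EndpointLayouts C K →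
                         ∀ x → LayoutStartingAt D (suc K) (inA x)
  layout-starting-at-A {K} layoutsA layoutsB layoutsC x
    with proj₁ (layoutsA x) | proj₁ (layoutsB b) | proj₁ (layoutsC c)
  ... | σA , widthA , starts | σB , widthB , _ | σC , widthC , _ =
    layout Δ σA σB σC , layout-width {K} {σA} {σB} {σC} widthA widthB widthC , layout-starts Δ σA σB σC starts

  layout-ending-at-C : ∀ {K} → EndpointLayouts A K → EndpointLayouts B K → EndpointLayouts C K →
                       ∀ z → LayoutEndingAt D (suc K) (inC z)
  layout-ending-at-C {K} layoutsA layoutsB layoutsC z
    with proj₂ (layoutsA a) | proj₂ (layoutsB b) | proj₂ (layoutsC z)
  ... | σA , widthA , _ | σB , widthB , _ | σC , widthC , ends =
    layout Δ σA σB σC , layout-width {K} {σA} {σB} {σC} widthA widthB widthC , layout-ends Δ σA σB σC ends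

EndpointLayouts-Δ : ∀ {D K} (Δ : DeltaComposition D) → let open DeltaComposition Δ in
                    EndpointLayouts A K → EndpointLayouts B K → EndpointLayouts C K → EndpointLayouts D (suc K)
EndpointLayouts-Δ {D} {K} Δ layoutsA layoutsB layoutsC =
  ∀-↔ parts {λ v → LayoutStartingAt D (suc K) v × LayoutEndingAt D (suc K) v} λ where
    (inj₁ x)        → layout-starting-at-A Δ layoutsA layoutsB layoutsC x ,
                      layout-ending-at-C (rotate Δ) layoutsB layoutsC layoutsA x
    (inj₂ (inj₁ y)) → layout-starting-at-A (rotate Δ) layoutsB layoutsC layoutsA y ,
                      layout-ending-at-C (rotate (rotate Δ)) layoutsC layoutsA layoutsB y
    (inj₂ (inj₂ z)) → layout-starting-at-A (rotate (rotate Δ)) layoutsC layoutsA layoutsB z ,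
                      layout-ending-at-C Δ layoutsA layoutsB layoutsC z
  where open DeltaComposition Δ

-- the piece whose threshold is the median is moved into position B
LinRkAtLeast-Δ : ∀ {D r} (Δ : DeltaComposition D) → let open DeltaComposition Δ in
                 Connected A → Connected B → Connected C →
                 LinRkAtLeast A (suc r) → LinRkAtLeast B (suc r) → LinRkAtLeast C (suc r) →
                 LinRkAtLeast D (suc (suc r))
LinRkAtLeast-Δ Δ connA connB connC lrA lrB lrC pos pos-injective
  with lrA (pos ∘ inA) (Embedding.injective (embeddingA Δ) ∘ pos-injective)
     | lrB (pos ∘ inB) (Embedding.injective (embeddingB Δ) ∘ pos-injective)
     | lrC (pos ∘ inC) (Embedding.injective (embeddingC Δ) ∘ pos-injective)
  where open DeltaComposition Δ
... | tA , rkA | tB , rkB | tC , rkC with tA ≤? tB | tB ≤? tC | tA ≤? tC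
... | yes A≤B | yes B≤C | _       =
  tB , cutRkAtLeast-sorted Δ pos A≤B B≤C connA connC rkA rkB rkC
... | yes A≤B | no  B≰C | yes A≤C =
  tC , cutRkAtLeast-sorted (swap-BC Δ) pos A≤C (<⇒≤ (≰⇒> B≰C)) connA connB rkA rkC rkB
... | yes A≤B | no  B≰C | no  A≰C =
  tA , cutRkAtLeast-sorted (rotate (rotate Δ)) pos (<⇒≤ (≰⇒> A≰C)) A≤B connC connB rkC rkA rkB
... | no  A≰B | yes B≤C | yes A≤C =
  tA , cutRkAtLeast-sorted (rotate (rotate (swap-BC Δ))) pos (<⇒≤ (≰⇒> A≰B)) A≤C connB connC rkB rkA rkC
... | no  A≰B | yes B≤C | no  A≰C =
  tC , cutRkAtLeast-sorted (rotate Δ) pos B≤C (<⇒≤ (≰⇒> A≰C)) connB connA rkB rkC rkA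
... | no  A≰B | no  B≰C | _       =
  tB , cutRkAtLeast-sorted (rotate (swap-BC Δ)) pos (<⇒≤ (≰⇒> B≰C)) (<⇒≤ (≰⇒> A≰B)) connC connA rkC rkB rkA

delta-composition : ∀ G₁ G₂ G₃ v₁ v₂ v₃ → DeltaComposition (delta G₁ G₂ G₃ v₁ v₂ v₃)
delta-composition G₁ G₂ G₃ v₁ v₂ v₃ = record
  { A = G₁ ; B = G₂ ; C = G₃ ; a = v₁ ; b = v₂ ; c = v₃
  ; parts     = ⊎³↔+
  ; adj-parts = λ u v → trans (join-adj G₁ H (_== v₁) q (map₂ join₂₃ u) (map₂ join₂₃ v)) (outer u v)
  }
  where
  H : Graph
  H = edgeJoin G₂ G₃ v₂ v₃

  join₂₃ : Fin (n G₂) ⊎ Fin (n G₃) → Fin (n H)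
  join₂₃ = Fin.join (n G₂) (n G₃)

  q : Fin (n H) → Bool
  q y = (y == (v₂ ↑ˡ n G₃)) ∨ (y == (n G₂ ↑ʳ v₃))

  q-join : ∀ u → q (join₂₃ u) ≡ [ _== v₂ , _== v₃ ]′ u
  q-join (inj₁ y) = cong₂ _∨_ (==-injective (↑ˡ-injective (n G₃) _ _) y v₂) (==-≢ (↑ˡ≢↑ʳ y v₃))
                    ⟨ trans ⟩ ∨-identityʳ (y == v₂)
  q-join (inj₂ z) = cong₂ _∨_ (==-≢ (↑ˡ≢↑ʳ v₂ z ∘ sym)) (==-injective (↑ʳ-injective (n G₂) _ _) z v₃)

  inner : ∀ u v → adj H (join₂₃ u) (join₂₃ v) ≡ deltaAdj G₁ G₂ G₃ v₁ v₂ v₃ (inj₂ u) (inj₂ v)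
  inner (inj₁ x) (inj₁ y) = join-adj G₂ G₃ _ _ (inj₁ x) (inj₁ y)
  inner (inj₁ x) (inj₂ y) = join-adj G₂ G₃ _ _ (inj₁ x) (inj₂ y)
  inner (inj₂ x) (inj₁ y) = join-adj G₂ G₃ _ _ (inj₂ x) (inj₁ y)
  inner (inj₂ x) (inj₂ y) = join-adj G₂ G₃ _ _ (inj₂ x) (inj₂ y)

  outer : ∀ u v → joinAdj G₁ H (_== v₁) q (map₂ join₂₃ u) (map₂ join₂₃ v)
                  ≡ deltaAdj G₁ G₂ G₃ v₁ v₂ v₃ u v
  outer (inj₁ x)        (inj₁ y)        = refl
  outer (inj₁ x)        (inj₂ v)        = cong ((x == v₁) ∧_) (q-join v)
  outer (inj₂ (inj₁ x)) (inj₁ y)        = cong (_∧ (y == v₁)) (q-join (inj₁ x))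
  outer (inj₂ (inj₂ x)) (inj₁ y)        = cong (_∧ (y == v₁)) (q-join (inj₂ x))
  outer (inj₂ u)        (inj₂ v)        = inner u v

-- The classes Δᵢ

K₂-adj : ∀ {x y : Fin 2} → x ≢ y → adj K₂ x y ≡ true
K₂-adj {zero}     {zero}     x≢y = contradiction refl x≢y
K₂-adj {zero}     {suc zero} _   = refl
K₂-adj {suc zero} {zero}     _   = refl
K₂-adj {suc zero} {suc zero} x≢y = contradiction refl x≢y

K₂-connected : Connected K₂
K₂-connected _ (x , x∈X) (y , y∉X) = x , y , x∈X , y∉X , K₂-adj λ { refl → y∉X x∈X }

K₂-linRkAtLeast : LinRkAtLeast K₂ 1
K₂-linRkAtLeast pos pos-injective with <-cmp (pos zero) (pos (suc zero))
... | tri< 0<1 _ _ = _ , edge⇒cutRkAtLeast-one {K₂} pos refl 0<1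
... | tri≈ _ 0≡1 _ = contradiction (pos-injective 0≡1) λ ()
... | tri> _ _ 1<0 = _ , edge⇒cutRkAtLeast-one {K₂} pos refl 1<0

K₂-width : ∀ σ → WidthAtMost K₂ σ 1
K₂-width _ _ = (λ _ _ → true) , (λ _ _ → true) , λ x w x∈X w∉X → K₂-adj λ { refl → w∉X x∈X }

K₂-reversed : Layout K₂
K₂-reversed = mk↔ₛ′ opposite opposite opposite-involutive opposite-involutive

K₂-endpointLayouts : EndpointLayouts K₂ 1
K₂-endpointLayouts zero =
  (↔-refl , K₂-width ↔-refl , λ _ → z≤n) ,
  (K₂-reversed , K₂-width K₂-reversed , λ { zero → ≤-refl ; (suc zero) → z≤n })
K₂-endpointLayouts (suc zero) =
  (K₂-reversed , K₂-width K₂-reversed , λ _ → z≤n) ,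
  (↔-refl , K₂-width ↔-refl , λ { zero → z≤n ; (suc zero) → ≤-refl })

InΔ⇒connected : ∀ {i G} → InΔ i G → Connected G
InΔ⇒connected {G = G} (base G≅K₂) = Connected-≅ {G} {K₂} G≅K₂ K₂-connected
InΔ⇒connected {G = G} (comp G₁ G₂ G₃ G₁∈Δ G₂∈Δ G₃∈Δ v₁ v₂ v₃ G≅D) =
  Connected-≅ {G} {delta G₁ G₂ G₃ v₁ v₂ v₃} G≅D
    (Connected-Δ (delta-composition G₁ G₂ G₃ v₁ v₂ v₃)
      (InΔ⇒connected G₁∈Δ) (InΔ⇒connected G₂∈Δ) (InΔ⇒connected G₃∈Δ))

InΔ⇒linRkAtLeast : ∀ {i G} → InΔ i G → LinRkAtLeast G (suc i)
InΔ⇒linRkAtLeast {G = G} (base G≅K₂) = embed-linRkAtLeast (≅⇒embedding⁻¹ {G} {K₂} G≅K₂) K₂-linRkAtLeast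
InΔ⇒linRkAtLeast {G = G} (comp G₁ G₂ G₃ G₁∈Δ G₂∈Δ G₃∈Δ v₁ v₂ v₃ G≅D) =
  embed-linRkAtLeast (≅⇒embedding⁻¹ {G} {delta G₁ G₂ G₃ v₁ v₂ v₃} G≅D)
    (LinRkAtLeast-Δ (delta-composition G₁ G₂ G₃ v₁ v₂ v₃)
      (InΔ⇒connected G₁∈Δ) (InΔ⇒connected G₂∈Δ) (InΔ⇒connected G₃∈Δ)
      (InΔ⇒linRkAtLeast G₁∈Δ) (InΔ⇒linRkAtLeast G₂∈Δ) (InΔ⇒linRkAtLeast G₃∈Δ))

InΔ⇒endpointLayouts : ∀ {i G} → InΔ i G → EndpointLayouts G (suc i)
InΔ⇒endpointLayouts {G = G} (base G≅K₂) = EndpointLayouts-≅ {G} {K₂} G≅K₂ K₂-endpointLayouts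
InΔ⇒endpointLayouts {G = G} (comp G₁ G₂ G₃ G₁∈Δ G₂∈Δ G₃∈Δ v₁ v₂ v₃ G≅D) =
  EndpointLayouts-≅ {G} {delta G₁ G₂ G₃ v₁ v₂ v₃} G≅D
    (EndpointLayouts-Δ (delta-composition G₁ G₂ G₃ v₁ v₂ v₃)
      (InΔ⇒endpointLayouts G₁∈Δ) (InΔ⇒endpointLayouts G₂∈Δ) (InΔ⇒endpointLayouts G₃∈Δ))

lemma3p5 : (k : ℕ) → 1 ≤ k → (G₁ G₂ : Graph) →
    InΔ (k ∸ 1) G₁ → InΔ (k ∸ 1) G₂ →
    (w₁ : Fin (n G₁)) (w₂ : Fin (n G₂)) →
    LinRankWidth (edgeJoin G₁ G₂ w₁ w₂) k
lemma3p5 (suc k) (s≤s z≤n) G₁ G₂ G₁∈Δ G₂∈Δ w₁ w₂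
  with proj₂ (InΔ⇒endpointLayouts G₁∈Δ w₁) | proj₁ (InΔ⇒endpointLayouts G₂∈Δ w₂)
... | σ₁ , width₁ , ends | σ₂ , width₂ , starts = (σ₁ ⊕ σ₂ , narrow) , wide
  where
  E : Graph
  E = edgeJoin G₁ G₂ w₁ w₂

  narrow : ∀ t → ¬ CutRkAtLeast E (InPrefix E (σ₁ ⊕ σ₂) t) (suc (suc k))
  narrow t = CutRkAtMost⇒¬CutRkAtLeast {E}
    (edgeJoin-width {G₁} {G₂} w₁ w₂ {k} {σ₁} {σ₂} width₁ ends width₂ starts t)

  wide : ∀ σ → ∃ λ t → CutRkAtLeast E (InPrefix E σ t) (suc k)
  wide σ = embed-linRkAtLeast (join-embeddingˡ G₁ G₂ _ _) (InΔ⇒linRkAtLeast G₁∈Δ)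
                             (position σ) (position-injective σ)
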